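{- Let $k$ have odd characteristic $p$. Treat $a, b, c, d_0, \dots, d_6$ as indeterminates, let $\kappa$ be the Kummer quartic associated with $D(x) = \sum_{i=0}^6 d_i x^i$, let $v = aX_1 + bX_2 + cX_3 + X_4$, and let $H_X$ be the $3 \times 3$ matrix defined below from the coefficients of $(v\kappa)^{p-1}$. Then $\det(H_X)$ is a non-zero polynomial which is homogeneous of degree $6(p-1)$ in $a, b, c, d_0, \dots, d_6$.
   Context: $\kappa(X_1,X_2,X_3,X_4) = K_2 X_4^2 + K_1 X_4 + K_0$ with $K_2 = X_2^2 - 4X_1X_3$, $K_1 = -2(2d_0X_1^3 + d_1X_1^2X_2 + 2d_2X_1^2X_3 + d_3X_1X_2X_3 + 2d_4X_1X_3^2 + d_5X_2X_3^2 + 2d_6X_3^3)$, $K_0 = (d_1^2-4d_0d_2)X_1^4 - 4d_0d_3X_1^3X_2 - 2d_1d_3X_1^3X_3 - 4d_0d_4X_1^2X_2^2 + 4(d_0d_5-d_1d_4)X_1^2X_2X_3 + (d_3^2+2d_1d_5-4d_2d_4-4d_0d_6)X_1^2X_3^2 - 4d_0d_5X_1X_2^3 + 4(2d_0d_6-d_1d_5)X_1X_2^2X_3 + 4(d_1d_6-d_2d_5)X_1X_2X_3^2 - 2d_3d_5X_1X_3^3 - 4d_0d_6X_2^4 - 4d_1d_6X_2^3X_3 - 4d_2d_6X_2^2X_3^2 - 4d_3d_6X_2X_3^3 + (d_5^2-4d_4d_6)X_3^4$ (for a smooth genus 2 curve $z^2=D(x)$ this is the Kummer surface of its Jacobian in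 $\mathbb{P}^3$). Writing $(v\kappa)^{p-1} = \sum c_{i_1,i_2,i_3,i_4} X_1^{i_1}X_2^{i_2}X_3^{i_3}X_4^{i_4}$, $H_X$ is the matrix with rows $(c_{2p-2,p-1,p-1,p-1} - a^p c_{p-2,p-1,p-1,2p-1},\ c_{p-2,2p-1,p-1,p-1} - b^p c_{p-2,p-1,p-1,2p-1},\ c_{p-2,p-1,2p-1,p-1} - c^p c_{p-2,p-1,p-1,2p-1})$, $(c_{2p-1,p-2,p-1,p-1} - a^p c_{p-1,p-2,p-1,2p-1},\ c_{p-1,2p-2,p-1,p-1} - b^p c_{p-1,p-2,p-1,2p-1},\ c_{p-1,p-2,2p-1,p-1} - c^p c_{p-1,p-2,p-1,2p-1})$, $(c_{2p-1,p-1,p-2,p-1} - a^p c_{p-1,p-1,p-2,2p-1},\ c_{p-1,2p-1,p-2,p-1} - b^p c_{p-1,p-1,p-2,2p-1},\ c_{p-1,p-1,2p-2,p-1} - c^p c_{p-1,p-1,p-2,2p-1})$; it is the Hasse-Witt matrix (in a suitable basis) of the plane section $X = V \cap K$, $V: v = 0$. -}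

module Defs where

open import Data.Nat as ℕ using (ℕ; zero; suc; _∸_)
open import Data.Integer as ℤ using (ℤ; +_; -_)
open import Data.Integer.Divisibility using () renaming (_∣_ to _∣ℤ_)
open import Data.Fin using (Fin; zero; suc)
open import Data.Vec as Vec using (Vec; []; _∷_; replicate; zipWith; updateAt; lookup)
open import Data.Vec.Properties using () renaming (≡-dec to vec≡-dec)
open import Data.List as List using (List; []; _∷_; _++_; concatMap; map; filter; foldr)
open import Data.Product using (_×_; _,_; proj₁; proj₂)
open import Relation.Binary.PropositionalEquality using (_≡_)
open import Relation.Nullary using (Dec; yes; no)

-- Polynomials with integer coefficients (un-normalised term lists).
-- Parameter variables (10): index 0 = a, 1 = b, 2 = c, 3+i = d_i (i = 0..6).
-- Kummer variables (4): index 0..3 = X1..X4.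
-- A polynomial is a formal sum of terms; its coefficient at a monomial is
-- the sum of the coefficients of all terms with that exponent vector.

PMon : Set
PMon = Vec ℕ 10

XMon : Set
XMon = Vec ℕ 4

PPoly : Set
PPoly = List (PMon × ℤ)

Poly : Set
Poly = List ((PMon × XMon) × ℤ)

module _ {M : Set} (_·_ : M → M → M) (one : M) where
  mulT : List (M × ℤ) → List (M × ℤ) → List (M × ℤ)
  mulT P Q = concatMap (λ t → map (λ s → (proj₁ t · proj₁ s) , (proj₂ t ℤ.* proj₂ s)) Q) P

  powT : List (M × ℤ) → ℕ → List (M × ℤ)
  powT P zero    = (one , + 1) ∷ []
  powT P (suc n) = mulT P (powT P n)

negT : {M : Set} → List (M × ℤ) → List (M × ℤ)
negT = map (λ t → proj₁ t , ℤ.- proj₂ t)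

_·P_ : PMon → PMon → PMon
_·P_ = zipWith ℕ._+_

_·X_ : XMon → XMon → XMon
_·X_ = zipWith ℕ._+_

_·PX_ : PMon × XMon → PMon × XMon → PMon × XMon
(m , e) ·PX (m' , e') = (m ·P m') , (e ·X e')

oneP : PMon
oneP = replicate 10 0

oneX : XMon
oneX = replicate 4 0

infixl 6 _⊕_ _⊖_
infixl 7 _⊗_
infixr 8 _^^_

_⊕_ : Poly → Poly → Poly
P ⊕ Q = P ++ Q

_⊖_ : Poly → Poly → Poly
P ⊖ Q = P ++ negT Q

_⊗_ : Poly → Poly → Poly
_⊗_ = mulT _·PX_ (oneP , oneX)

_^^_ : Poly → ℕ → Poly
_^^_ = powT _·PX_ (oneP , oneX)

lit : ℤ → Poly
lit z = ((oneP , oneX) , z) ∷ []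

pvar : Fin 10 → Poly
pvar i = ((updateAt oneP i (λ _ → 1) , oneX) , + 1) ∷ []

xvar : Fin 4 → Poly
xvar j = ((oneP , updateAt oneX j (λ _ → 1)) , + 1) ∷ []

A B C : Poly
A = pvar (Data.Fin.fromℕ< {0} (ℕ.s≤s ℕ.z≤n))
B = pvar (suc zero)
C = pvar (suc (suc zero))

d : Fin 7 → Poly
d i = pvar (suc (suc (suc (Data.Fin.inject≤ i (ℕ.s≤s (ℕ.s≤s (ℕ.s≤s (ℕ.s≤s (ℕ.s≤s (ℕ.s≤s (ℕ.s≤s ℕ.z≤n)))))))))))

d0 d1 d2 d3 d4 d5 d6 : Poly
d0 = d (Data.Fin.fromℕ< {0} (ℕ.s≤s ℕ.z≤n))
d1 = d (suc zero)
d2 = d (suc (suc zero))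
d3 = d (suc (suc (suc zero)))
d4 = d (suc (suc (suc (suc zero))))
d5 = d (suc (suc (suc (suc (suc zero)))))
d6 = d (suc (suc (suc (suc (suc (suc zero))))))

X1 X2 X3 X4 : Poly
X1 = xvar zero
X2 = xvar (suc zero)
X3 = xvar (suc (suc zero))
X4 = xvar (suc (suc (suc zero)))

n : ℕ → Poly
n k = lit (+ k)

K2 : Poly
K2 = X2 ^^ 2 ⊖ n 4 ⊗ X1 ⊗ X3

K1 : Poly
K1 = lit (- (+ 2)) ⊗
     ( n 2 ⊗ d0 ⊗ X1 ^^ 3 ⊕ d1 ⊗ X1 ^^ 2 ⊗ X2 ⊕ n 2 ⊗ d2 ⊗ X1 ^^ 2 ⊗ X3
     ⊕ d3 ⊗ X1 ⊗ X2 ⊗ X3 ⊕ n 2 ⊗ d4 ⊗ X1 ⊗ X3 ^^ 2 ⊕ d5 ⊗ X2 ⊗ X3 ^^ 2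
     ⊕ n 2 ⊗ d6 ⊗ X3 ^^ 3 )

K0 : Poly
K0 = (d1 ^^ 2 ⊖ n 4 ⊗ d0 ⊗ d2) ⊗ X1 ^^ 4
   ⊖ n 4 ⊗ d0 ⊗ d3 ⊗ X1 ^^ 3 ⊗ X2
   ⊖ n 2 ⊗ d1 ⊗ d3 ⊗ X1 ^^ 3 ⊗ X3
   ⊖ n 4 ⊗ d0 ⊗ d4 ⊗ X1 ^^ 2 ⊗ X2 ^^ 2
   ⊕ n 4 ⊗ (d0 ⊗ d5 ⊖ d1 ⊗ d4) ⊗ X1 ^^ 2 ⊗ X2 ⊗ X3
   ⊕ (d3 ^^ 2 ⊕ n 2 ⊗ d1 ⊗ d5 ⊖ n 4 ⊗ d2 ⊗ d4 ⊖ n 4 ⊗ d0 ⊗ d6) ⊗ X1 ^^ 2 ⊗ X3 ^^ 2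
   ⊖ n 4 ⊗ d0 ⊗ d5 ⊗ X1 ⊗ X2 ^^ 3
   ⊕ n 4 ⊗ (n 2 ⊗ d0 ⊗ d6 ⊖ d1 ⊗ d5) ⊗ X1 ⊗ X2 ^^ 2 ⊗ X3
   ⊕ n 4 ⊗ (d1 ⊗ d6 ⊖ d2 ⊗ d5) ⊗ X1 ⊗ X2 ⊗ X3 ^^ 2
   ⊖ n 2 ⊗ d3 ⊗ d5 ⊗ X1 ⊗ X3 ^^ 3
   ⊖ n 4 ⊗ d0 ⊗ d6 ⊗ X2 ^^ 4
   ⊖ n 4 ⊗ d1 ⊗ d6 ⊗ X2 ^^ 3 ⊗ X3
   ⊖ n 4 ⊗ d2 ⊗ d6 ⊗ X2 ^^ 2 ⊗ X3 ^^ 2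
   ⊖ n 4 ⊗ d3 ⊗ d6 ⊗ X2 ⊗ X3 ^^ 3
   ⊕ (d5 ^^ 2 ⊖ n 4 ⊗ d4 ⊗ d6) ⊗ X3 ^^ 4

κ : Poly
κ = K2 ⊗ X4 ^^ 2 ⊕ K1 ⊗ X4 ⊕ K0

v : Poly
v = A ⊗ X1 ⊕ B ⊗ X2 ⊕ C ⊗ X3 ⊕ X4

coeffX : XMon → Poly → PPoly
coeffX e P = map (λ t → proj₁ (proj₁ t) , proj₂ t)
                 (filter (λ t → vec≡-dec ℕ._≟_ (proj₂ (proj₁ t)) e) P)

coeffP : PMon → PPoly → ℤ
coeffP m P = foldr (λ t acc → proj₂ t ℤ.+ acc) (+ 0)
                   (filter (λ t → vec≡-dec ℕ._≟_ (proj₁ t) m) P)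

infixl 6 _⊕'_ _⊖'_
infixl 7 _⊗'_
infixr 8 _^'_

_⊕'_ : PPoly → PPoly → PPoly
P ⊕' Q = P ++ Q

_⊖'_ : PPoly → PPoly → PPoly
P ⊖' Q = P ++ negT Q

_⊗'_ : PPoly → PPoly → PPoly
_⊗'_ = mulT _·P_ oneP

_^'_ : PPoly → ℕ → PPoly
_^'_ = powT _·P_ oneP

pvar' : Fin 10 → PPoly
pvar' i = (updateAt oneP i (λ _ → 1) , + 1) ∷ []

a' b' c' : PPoly
a' = pvar' zero
b' = pvar' (suc zero)
c' = pvar' (suc (suc zero))

deg : PMon → ℕ
deg = Vec.sum

module HW (p : ℕ) where
  F : Poly
  F = (v ⊗ κ) ^^ (p ∸ 1)

  c : ℕ → ℕ → ℕ → ℕ → PPoly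
  c i1 i2 i3 i4 = coeffX (i1 ∷ i2 ∷ i3 ∷ i4 ∷ []) F

  p1 p2 2p1 2p2 : ℕ
  p1  = p ∸ 1
  p2  = p ∸ 2
  2p1 = 2 ℕ.* p ∸ 1
  2p2 = 2 ℕ.* p ∸ 2

  H : Fin 3 → Fin 3 → PPoly
  H zero zero = c 2p2 p1 p1 p1 ⊖' (a' ^' p) ⊗' c p2 p1 p1 2p1
  H zero (suc zero) = c p2 2p1 p1 p1 ⊖' (b' ^' p) ⊗' c p2 p1 p1 2p1
  H zero (suc (suc zero)) = c p2 p1 2p1 p1 ⊖' (c' ^' p) ⊗' c p2 p1 p1 2p1
  H (suc zero) zero = c 2p1 p2 p1 p1 ⊖' (a' ^' p) ⊗' c p1 p2 p1 2p1
  H (suc zero) (suc zero) = c p1 2p2 p1 p1 ⊖' (b' ^' p) ⊗' c p1 p2 p1 2p1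
  H (suc zero) (suc (suc zero)) = c p1 p2 2p1 p1 ⊖' (c' ^' p) ⊗' c p1 p2 p1 2p1
  H (suc (suc zero)) zero = c 2p1 p1 p2 p1 ⊖' (a' ^' p) ⊗' c p1 p1 p2 2p1
  H (suc (suc zero)) (suc zero) = c p1 2p1 p2 p1 ⊖' (b' ^' p) ⊗' c p1 p1 p2 2p1
  H (suc (suc zero)) (suc (suc zero)) = c p1 p1 2p2 p1 ⊖' (c' ^' p) ⊗' c p1 p1 p2 2p1

  det3 : (Fin 3 → Fin 3 → PPoly) → PPoly
  det3 M = (m00 ⊗' (m11 ⊗' m22 ⊖' m12 ⊗' m21))
         ⊖' (m01 ⊗' (m10 ⊗' m22 ⊖' m12 ⊗' m20))
         ⊕' (m02 ⊗' (m10 ⊗' m21 ⊖' m11 ⊗' m20))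
    where
    i0 i1 i2 : Fin 3
    i0 = zero
    i1 = suc zero
    i2 = suc (suc zero)
    m00 = M i0 i0
    m01 = M i0 i1
    m02 = M i0 i2
    m10 = M i1 i0
    m11 = M i1 i1
    m12 = M i1 i2
    m20 = M i2 i0
    m21 = M i2 i1
    m22 = M i2 i2

  detH : PPoly
  detH = det3 H

detHX : ℕ → PPoly
detHX p = HW.detH p

-- "P is nonzero after reduction to characteristic p": some coefficient is not ≡ 0 mod p
NonZeroMod : ℕ → PPoly → Set
NonZeroMod p P = Data.Product.Σ PMon (λ m → Relation.Nullary.¬ ((+ p) ∣ℤ coeffP m P))

-- "P is homogeneous of degree k after reduction mod p"
HomogeneousMod : ℕ → ℕ → PPoly → Set
HomogeneousMod p k P = (m : PMon) → Relation.Nullary.¬ ((+ p) ∣ℤ coeffP m P) → deg m ≡ k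

-- Degree: vκ is homogeneous of degree 3 for the grading "degree in a, b, c, d₀, …, d₆ plus the
-- exponent of X₄", so the coefficient of X^e in (vκ)^(p−1) has degree 3(p−1) − e₄; every entry of
-- H_X then has degree 2(p−1).
-- Non-vanishing: weight the parameters by paramWeights and, for column j, the X's by xWeights j.
-- Then −4·leadingMonomial j is the unique heaviest term of vκ, so (vκ)^(p−1) has the unique
-- heaviest term (−4)^(p−1)·(leadingMonomial j)^(p−1), whose X-part is the exponent read off by
-- H_jj.  Hence, for suitable potentials u and v, H_jj has a unique heaviest monomial, of weight
-- u_j + v_j and coefficient (−4)^(p−1), while H_ij (i ≠ j) is lighter than u_i + v_j.  So only the
-- diagonal product reaches the top weight of det H_X, with coefficient (−4)^(3(p−1)), a unit mod p.
-- All the weight inequalities are between linear forms in s = p − 2 and are decided coefficientwise.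

module Submission where

open import Defs
open import Data.Nat using (ℕ; zero; suc; _+_; _*_; _∸_; _^_; _≤_; _<_; _≟_; _≤?_; _<?_)
import Data.Nat.Properties as ℕ
open import Data.Nat.Properties
  using (≤-refl; ≤-trans; ≤-antisym; <-irrefl; ≤∧≢⇒<; +-mono-≤; +-mono-<-≤; +-monoʳ-≤;
         +-cancelˡ-≡; +-cancelʳ-≡; +-cancelʳ-≤; +-cancelʳ-<)
open import Data.Nat.Divisibility using (_∣_; ∣1⇒≡1; _∣0)
open import Data.Nat.Primality using (Prime; euclidsLemma; ¬prime[0]; ¬prime[1]; irreducible[2])
open import Data.Nat.Tactic.RingSolver using (solve-∀)
open import Data.Integer as ℤ using (ℤ; -[1+_])
import Data.Integer.Properties as ℤ
open import Data.Fin using (Fin; zero; suc; _↑ˡ_; #_)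
import Data.Fin.Properties as Fin
open import Data.Vec as Vec using (Vec; []; _∷_; zipWith; replicate)
open import Data.Vec.Properties using (map-cong; map-∘; map-const) renaming (≡-dec to vec≡-dec)
open import Data.List using (List; []; _∷_; _++_; map)
open import Data.List.Properties using (++-identityʳ)
open import Data.List.Relation.Unary.All as All using (All; []; _∷_)
open import Data.List.Relation.Unary.All.Properties using (++⁺; map⁺; all-filter; filter⁺)
open import Data.Product using (_×_; _,_; proj₁; proj₂)
open import Data.Product.Properties using () renaming (≡-dec to ×-≡-dec)
open import Data.Sum using (inj₁; inj₂; [_,_])
open import Data.Empty using (⊥-elim)
open import Function using (_∘_)
open import Relation.Binary.PropositionalEquality hiding ([_])
open import Relation.Nullary using (Dec; ¬_; yes; no)
open import Relation.Nullary.Decidable using (toWitness; map′; ¬?; _×-dec_; _→-dec_)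

+-≡-tight : ∀ {a b α β} → a ≤ α → b ≤ β → a + b ≡ α + β → a ≡ α × b ≡ β
+-≡-tight {a} {b} {α} {β} a≤α b≤β eq = a≡α , +-cancelˡ-≡ α b β (trans (cong (_+ b) (sym a≡α)) eq)
  where
  a≡α : a ≡ α
  a≡α = ≤-antisym a≤α (+-cancelʳ-≤ β α a (≤-trans (ℕ.≤-reflexive (sym eq)) (+-monoʳ-≤ a b≤β)))

+-monoʳ-<-shift : ∀ k a {b c} → k + b < c → k + (a + b) < a + c
+-monoʳ-<-shift k a {b} {c} k+b<c = subst (_< a + c) (lemma k a b) (ℕ.+-monoʳ-< a k+b<c)
  where
  lemma : ∀ k a b → a + (k + b) ≡ k + (a + b)
  lemma = solve-∀

monoidPow : {M : Set} → (M → M → M) → M → M → ℕ → M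
monoidPow _·_ ε m zero    = ε
monoidPow _·_ ε m (suc n) = m · monoidPow _·_ ε m n

module Weighted {M : Set} (_·_ : M → M → M) (ε : M) (w : M → ℕ)
                (w-· : ∀ x y → w (x · y) ≡ w x + w y) (w-ε : w ε ≡ 0) where

  Term : Set
  Term = M × ℤ

  infixl 7 _⊛_
  _⊛_ : List Term → List Term → List Term
  _⊛_ = mulT _·_ ε

  _^ₜ_ : List Term → ℕ → List Term
  _^ₜ_ = powT _·_ ε

  _⋆_ : Term → Term → Term
  (x , a) ⋆ (y , b) = x · y , a ℤ.* b

  All-⊛ : ∀ {R S T : Term → Set} → (∀ {x y} → R x → S y → T (x ⋆ y)) →
          ∀ {P Q} → All R P → All S Q → All T (P ⊛ Q)
  All-⊛ f []       _  = []
  All-⊛ f (r ∷ rs) ss = ++⁺ (map⁺ (All.map (f r) ss)) (All-⊛ f rs ss)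

  Weights : (ℕ → Set) → List Term → Set
  Weights Q = All (Q ∘ w ∘ proj₁)

  Weights-⊛ : ∀ {Q R S : ℕ → Set} → (∀ {a b} → Q a → R b → S (a + b)) →
              ∀ {P P'} → Weights Q P → Weights R P' → Weights S (P ⊛ P')
  Weights-⊛ {S = S} f = All-⊛ (λ {x} {y} q r → subst S (sym (w-· (proj₁ x) (proj₁ y))) (f q r))

  AtMost Below Homogeneous : ℕ → List Term → Set
  AtMost K      = Weights (_≤ K)
  Below K       = Weights (_< K)
  Homogeneous K = Weights (_≡ K)

  AtMost-≡ : ∀ {K K' P} → K ≡ K' → AtMost K P → AtMost K' P
  AtMost-≡ {P = P} K≡K' = subst (λ K → AtMost K P) K≡K'

  Below-≡ : ∀ {K K' P} → K ≡ K' → Below K P → Below K' P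
  Below-≡ {P = P} K≡K' = subst (λ K → Below K P) K≡K'

  Homogeneous-≡ : ∀ {K K' P} → K ≡ K' → Homogeneous K P → Homogeneous K' P
  Homogeneous-≡ {P = P} K≡K' = subst (λ K → Homogeneous K P) K≡K'

  AtMost-⊛ : ∀ {α β P Q} → AtMost α P → AtMost β Q → AtMost (α + β) (P ⊛ Q)
  AtMost-⊛ {α} {β} = Weights-⊛ {_≤ α} {_≤ β} {_≤ α + β} +-mono-≤

  Below-⊛ : ∀ {α β P Q} → Below α P → AtMost β Q → Below (α + β) (P ⊛ Q)
  Below-⊛ {α} {β} = Weights-⊛ {_< α} {_≤ β} {_< α + β} +-mono-<-≤

  Homogeneous-⊛ : ∀ {α β P Q} → Homogeneous α P → Homogeneous β Q → Homogeneous (α + β) (P ⊛ Q)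
  Homogeneous-⊛ {α} {β} = Weights-⊛ {_≡ α} {_≡ β} {_≡ α + β} (cong₂ _+_)

  Homogeneous-^ : ∀ {α P} n → Homogeneous α P → Homogeneous (n * α) (P ^ₜ n)
  Homogeneous-^ zero    h = w-ε ∷ []
  Homogeneous-^ (suc n) h = Homogeneous-⊛ h (Homogeneous-^ n h)

  Dominated : M → M → Set
  Dominated m x = w x ≤ w m × (w x ≡ w m → x ≡ m)

  Leads : M → List Term → Set
  Leads m = All (Dominated m ∘ proj₁)

  Leads⇒AtMost : ∀ {m P} → Leads m P → AtMost (w m) P
  Leads⇒AtMost = All.map proj₁

  Below⇒AtMost : ∀ {K P} → Below K P → AtMost K P
  Below⇒AtMost = All.map ℕ.<⇒≤

  Below⇒Leads : ∀ {m P} → Below (w m) P → Leads m P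
  Below⇒Leads = All.map (λ x<m → ℕ.<⇒≤ x<m , λ x≡m → ⊥-elim (<-irrefl x≡m x<m))

  Dominated-· : ∀ {m n x y} → Dominated m x → Dominated n y → Dominated (m · n) (x · y)
  Dominated-· {m} {n} {x} {y} (x≤m , x≡m) (y≤n , y≡n) =
    subst₂ _≤_ (sym (w-· x y)) (sym (w-· m n)) (+-mono-≤ x≤m y≤n) ,
    λ eq → let x≡ , y≡ = +-≡-tight x≤m y≤n (trans (sym (w-· x y)) (trans eq (w-· m n)))
           in cong₂ _·_ (x≡m x≡) (y≡n y≡)

  Leads-⊛ : ∀ {m n P Q} → Leads m P → Leads n Q → Leads (m · n) (P ⊛ Q)
  Leads-⊛ = All-⊛ Dominated-·

  _^ₘ_ : M → ℕ → M
  _^ₘ_ = monoidPow _·_ ε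

  w-^ₘ : ∀ m n → w (m ^ₘ n) ≡ n * w m
  w-^ₘ m zero    = w-ε
  w-^ₘ m (suc n) = trans (w-· m (m ^ₘ n)) (cong (w m +_) (w-^ₘ m n))

  Leads-^ : ∀ {m P} n → Leads m P → Leads (m ^ₘ n) (P ^ₜ n)
  Leads-^ zero    l = (≤-refl , λ _ → refl) ∷ []
  Leads-^ (suc n) l = Leads-⊛ l (Leads-^ n l)

  AtMost-^ : ∀ {α P} n → AtMost α P → AtMost (n * α) (P ^ₜ n)
  AtMost-^ zero    b = ℕ.≤-reflexive w-ε ∷ []
  AtMost-^ (suc n) b = AtMost-⊛ b (AtMost-^ n b)

  weightCoeff : ℕ → List Term → ℤ
  weightCoeff K []            = ℤ.0ℤ
  weightCoeff K ((x , a) ∷ P) with w x ≟ K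
  ... | yes _ = a ℤ.+ weightCoeff K P
  ... | no _  = weightCoeff K P

  weightCoeff-++ : ∀ K P Q → weightCoeff K (P ++ Q) ≡ weightCoeff K P ℤ.+ weightCoeff K Q
  weightCoeff-++ K []            Q = sym (ℤ.+-identityˡ _)
  weightCoeff-++ K ((x , a) ∷ P) Q with w x ≟ K
  ... | yes _ = trans (cong (λ z → a ℤ.+ z) (weightCoeff-++ K P Q)) (sym (ℤ.+-assoc a _ _))
  ... | no _  = weightCoeff-++ K P Q

  weightCoeff-negT : ∀ K P → weightCoeff K (negT P) ≡ ℤ.- weightCoeff K P
  weightCoeff-negT K []            = refl
  weightCoeff-negT K ((x , a) ∷ P) with w x ≟ K
  ... | yes _ = trans (cong (λ z → ℤ.- a ℤ.+ z) (weightCoeff-negT K P)) (sym (ℤ.neg-distrib-+ a _))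
  ... | no _  = weightCoeff-negT K P

  weightCoeff-Below : ∀ {K P} → Below K P → weightCoeff K P ≡ ℤ.0ℤ
  weightCoeff-Below {K} {[]}          []           = refl
  weightCoeff-Below {K} {(x , a) ∷ P} (x<K ∷ below) with w x ≟ K
  ... | yes x≡K = ⊥-elim (<-irrefl x≡K x<K)
  ... | no _    = weightCoeff-Below below

  weightCoeff-scale : ∀ {α β} t Q → w (proj₁ t) ≡ α → AtMost β Q →
                      weightCoeff (α + β) (map (t ⋆_) Q) ≡ proj₂ t ℤ.* weightCoeff β Q
  weightCoeff-scale {α} {β} (x , a) []            x≡α []          = sym (ℤ.*-zeroʳ a)
  weightCoeff-scale {α} {β} (x , a) ((y , b) ∷ Q) x≡α (y≤β ∷ Q≤β)
    with w (x · y) ≟ α + β | w y ≟ β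
  ... | yes _ | yes _ = trans (cong (λ z → a ℤ.* b ℤ.+ z) (weightCoeff-scale (x , a) Q x≡α Q≤β))
                             (sym (ℤ.*-distribˡ-+ a b _))
  ... | no xy≢ | yes y≡β = ⊥-elim (xy≢ (trans (w-· x y) (cong₂ _+_ x≡α y≡β)))
  ... | yes xy≡ | no y≢β =
    ⊥-elim (y≢β (+-cancelˡ-≡ α _ _ (trans (cong (_+ w y) (sym x≡α)) (trans (sym (w-· x y)) xy≡))))
  ... | no _ | no _ = weightCoeff-scale (x , a) Q x≡α Q≤β

  weightCoeff-⊛ : ∀ {α β P Q} → AtMost α P → AtMost β Q →
                  weightCoeff (α + β) (P ⊛ Q) ≡ weightCoeff α P ℤ.* weightCoeff β Q
  weightCoeff-⊛ {α} {β} {[]}          {Q} []           Q≤β = refl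
  weightCoeff-⊛ {α} {β} {(x , a) ∷ P} {Q} (x≤α ∷ P≤α) Q≤β with w x ≟ α
  ... | yes x≡α = begin
    weightCoeff (α + β) (map ((x , a) ⋆_) Q ++ P ⊛ Q)
      ≡⟨ weightCoeff-++ (α + β) (map ((x , a) ⋆_) Q) (P ⊛ Q) ⟩
    weightCoeff (α + β) (map ((x , a) ⋆_) Q) ℤ.+ weightCoeff (α + β) (P ⊛ Q)
      ≡⟨ cong₂ ℤ._+_ (weightCoeff-scale (x , a) Q x≡α Q≤β) (weightCoeff-⊛ P≤α Q≤β) ⟩
    a ℤ.* weightCoeff β Q ℤ.+ weightCoeff α P ℤ.* weightCoeff β Q
      ≡⟨ ℤ.*-distribʳ-+ (weightCoeff β Q) a _ ⟨
    (a ℤ.+ weightCoeff α P) ℤ.* weightCoeff β Q ∎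
    where open ≡-Reasoning
  ... | no x≢α = begin
    weightCoeff (α + β) (map ((x , a) ⋆_) Q ++ P ⊛ Q)
      ≡⟨ weightCoeff-++ (α + β) (map ((x , a) ⋆_) Q) (P ⊛ Q) ⟩
    weightCoeff (α + β) (map ((x , a) ⋆_) Q) ℤ.+ weightCoeff (α + β) (P ⊛ Q)
      ≡⟨ cong₂ ℤ._+_ (weightCoeff-Below x⋆Q-Below) (weightCoeff-⊛ P≤α Q≤β) ⟩
    ℤ.0ℤ ℤ.+ weightCoeff α P ℤ.* weightCoeff β Q
      ≡⟨ ℤ.+-identityˡ _ ⟩
    weightCoeff α P ℤ.* weightCoeff β Q ∎
    where
    open ≡-Reasoning
    x⋆Q-Below : Below (α + β) (map ((x , a) ⋆_) Q)
    x⋆Q-Below = subst (Below (α + β)) (++-identityʳ _)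
                      (Below-⊛ {P = (x , a) ∷ []} (≤∧≢⇒< x≤α x≢α ∷ []) Q≤β)

  weightCoeff-^ : ∀ {α P} n → AtMost α P → weightCoeff (n * α) (P ^ₜ n) ≡ weightCoeff α P ℤ.^ n
  weightCoeff-^ zero    P≤α with w ε ≟ 0
  ... | yes _   = refl
  ... | no w≢0 = ⊥-elim (w≢0 w-ε)
  weightCoeff-^ {α} {P} (suc n) P≤α =
    trans (weightCoeff-⊛ P≤α (AtMost-^ n P≤α)) (cong (weightCoeff α P ℤ.*_) (weightCoeff-^ n P≤α))

  weightCoeff-++-Below : ∀ {K} P {Q} → Below K Q → weightCoeff K (P ++ Q) ≡ weightCoeff K P
  weightCoeff-++-Below {K} P {Q} Q<K = begin
    weightCoeff K (P ++ Q)                   ≡⟨ weightCoeff-++ K P Q ⟩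
    weightCoeff K P ℤ.+ weightCoeff K Q     ≡⟨ cong (ℤ._+_ (weightCoeff K P)) (weightCoeff-Below Q<K) ⟩
    weightCoeff K P ℤ.+ ℤ.0ℤ                ≡⟨ ℤ.+-identityʳ _ ⟩
    weightCoeff K P                          ∎
    where open ≡-Reasoning

  weightCoeff-⊖-Below : ∀ {K} P {Q} → Below K Q → weightCoeff K (P ++ negT Q) ≡ weightCoeff K P
  weightCoeff-⊖-Below P Q<K = weightCoeff-++-Below P (map⁺ Q<K)

  Leads-++-Below : ∀ {m P Q} → Leads m P → Below (w m) Q → Leads m (P ++ Q)
  Leads-++-Below P-lead Q<m = ++⁺ P-lead (Below⇒Leads Q<m)

  Leads-⊖-Below : ∀ {m P Q} → Leads m P → Below (w m) Q → Leads m (P ++ negT Q)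
  Leads-⊖-Below P-lead Q<m = Leads-++-Below P-lead (map⁺ Q<m)

  weightCoeff-Leads-⊛ : ∀ {m n P Q} → Leads m P → Leads n Q →
                        weightCoeff (w (m · n)) (P ⊛ Q) ≡ weightCoeff (w m) P ℤ.* weightCoeff (w n) Q
  weightCoeff-Leads-⊛ {m} {n} {P} {Q} P-lead Q-lead =
    trans (cong (λ K → weightCoeff K (P ⊛ Q)) (w-· m n))
          (weightCoeff-⊛ (Leads⇒AtMost P-lead) (Leads⇒AtMost Q-lead))

  Leads-⊛-⊖-Below : ∀ {m n P Q R} → Leads m P → Leads n Q → Below (w (m · n)) R →
                    Leads (m · n) (P ⊛ Q ++ negT R) ×
                    weightCoeff (w (m · n)) (P ⊛ Q ++ negT R) ≡ weightCoeff (w m) P ℤ.* weightCoeff (w n) Q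
  Leads-⊛-⊖-Below {P = P} {Q} P-lead Q-lead R-below =
    Leads-⊖-Below (Leads-⊛ P-lead Q-lead) R-below ,
    trans (weightCoeff-⊖-Below (P ⊛ Q) R-below) (weightCoeff-Leads-⊛ P-lead Q-lead)

dot : ∀ {n} → Vec ℕ n → Vec ℕ n → ℕ
dot []       []       = 0
dot (a ∷ as) (x ∷ xs) = a * x + dot as xs

dot-zipWith : ∀ {n} (u x y : Vec ℕ n) → dot u (zipWith _+_ x y) ≡ dot u x + dot u y
dot-zipWith []       []       []       = refl
dot-zipWith (a ∷ u) (x ∷ xs) (y ∷ ys) rewrite dot-zipWith u xs ys = lemma a x y (dot u xs) (dot u ys)
  where
  lemma : ∀ a x y s t → a * (x + y) + (s + t) ≡ (a * x + s) + (a * y + t)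
  lemma = solve-∀

dot-replicate-0 : ∀ {n} (u : Vec ℕ n) → dot u (replicate n 0) ≡ 0
dot-replicate-0 []      = refl
dot-replicate-0 (a ∷ u) rewrite ℕ.*-zeroʳ a = dot-replicate-0 u

sum-zipWith : ∀ {n} (x y : Vec ℕ n) → Vec.sum (zipWith _+_ x y) ≡ Vec.sum x + Vec.sum y
sum-zipWith []       []       = refl
sum-zipWith (x ∷ xs) (y ∷ ys) rewrite sum-zipWith xs ys = lemma x y (Vec.sum xs) (Vec.sum ys)
  where
  lemma : ∀ a b c d → (a + b) + (c + d) ≡ (a + c) + (b + d)
  lemma = solve-∀

entry : Poly → XMon → PPoly → XMon → PPoly
entry F e₁ x e₂ = coeffX e₁ F ⊖' x ⊗' coeffX e₂ F

module Coefficients (wP : PMon → ℕ) (wP-· : ∀ x y → wP (x ·P y) ≡ wP x + wP y) (wP-ε : wP oneP ≡ 0) where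

  open Weighted _·P_ oneP wP wP-· wP-ε public

  coeffP-Leads : ∀ {m} Q → Leads m Q → coeffP m Q ≡ weightCoeff (wP m) Q
  coeffP-Leads             []             []                    = refl
  coeffP-Leads {m} ((m' , a) ∷ Q) ((m'≤m , m'≡m) ∷ lead) with vec≡-dec ℕ._≟_ m' m | wP m' ≟ wP m
  ... | yes refl | yes _     = cong (ℤ._+_ a) (coeffP-Leads Q lead)
  ... | yes refl | no w≢     = ⊥-elim (w≢ refl)
  ... | no m'≢m  | yes w≡    = ⊥-elim (m'≢m (m'≡m w≡))
  ... | no _     | no _      = coeffP-Leads Q lead

  coeffP-Homogeneous : ∀ {K m} Q → Homogeneous K Q → wP m ≢ K → coeffP m Q ≡ ℤ.0ℤ
  coeffP-Homogeneous             []             []          _   = refl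
  coeffP-Homogeneous {m = m} ((m' , a) ∷ Q) (m'≡K ∷ hom) m≢K with vec≡-dec ℕ._≟_ m' m
  ... | yes refl = ⊥-elim (m≢K m'≡K)
  ... | no _     = coeffP-Homogeneous Q hom m≢K

  module Joint (W : Vec ℕ 4) where

    joint : PMon × XMon → ℕ
    joint (m , e) = wP m + dot W e

    joint-· : ∀ x y → joint (x ·PX y) ≡ joint x + joint y
    joint-· (m , e) (m' , e') rewrite wP-· m m' | dot-zipWith W e e' = lemma (wP m) (wP m') (dot W e) (dot W e')
      where
      lemma : ∀ a b c d → (a + b) + (c + d) ≡ (a + c) + (b + d)
      lemma = solve-∀

    joint-ε : joint (oneP , oneX) ≡ 0
    joint-ε rewrite wP-ε = dot-replicate-0 W

    module J = Weighted _·PX_ (oneP , oneX) joint joint-· joint-ε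

    coeffX-All : ∀ {R : PMon × XMon → Set} {S : PMon → Set} e P →
                 (∀ {m} → R (m , e) → S m) → All (R ∘ proj₁) P → All (S ∘ proj₁) (coeffX e P)
    coeffX-All {R} e P f all =
      map⁺ (All.map (λ {t} (r , e'≡e) → f (subst (λ e' → R (proj₁ (proj₁ t) , e')) e'≡e r))
                    (All.zip (filter⁺ _ all , all-filter (λ t → vec≡-dec ℕ._≟_ (proj₂ (proj₁ t)) e) P)))

    coeffX-Leads : ∀ {m e} P → J.Leads (m , e) P → Leads m (coeffX e P)
    coeffX-Leads {m} {e} P = coeffX-All e P λ {m'} (m'≤m , m'≡m) →
      +-cancelʳ-≤ (dot W e) (wP m') (wP m) m'≤m ,
      λ w≡ → cong proj₁ (m'≡m (cong (_+ dot W e) w≡))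

    weightCoeff-coeffX : ∀ {m e} P → J.Leads (m , e) P →
                         weightCoeff (wP m) (coeffX e P) ≡ J.weightCoeff (joint (m , e)) P
    weightCoeff-coeffX             []                   []                  = refl
    weightCoeff-coeffX {m} {e} (((m' , e') , a) ∷ P) ((_ , uniq) ∷ lead) with vec≡-dec ℕ._≟_ e' e
    ... | yes refl with wP m' ≟ wP m | joint (m' , e) ≟ joint (m , e)
    ...   | yes _  | yes _  = cong (ℤ._+_ a) (weightCoeff-coeffX P lead)
    ...   | yes w≡ | no j≢  = ⊥-elim (j≢ (cong (_+ dot W e) w≡))
    ...   | no w≢  | yes j≡ = ⊥-elim (w≢ (+-cancelʳ-≡ (dot W e) (wP m') (wP m) j≡))
    ...   | no _   | no _   = weightCoeff-coeffX P lead
    weightCoeff-coeffX {m} {e} (((m' , e') , a) ∷ P) ((_ , uniq) ∷ lead) | no e'≢e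
      with joint (m' , e') ≟ joint (m , e)
    ... | yes j≡ = ⊥-elim (e'≢e (cong proj₂ (uniq j≡)))
    ... | no _   = weightCoeff-coeffX P lead

    coeffX-Below : ∀ {R K} e F → J.AtMost R F → R < K + dot W e → Below K (coeffX e F)
    coeffX-Below {R} {K} e F F≤R R<K+e =
      coeffX-All {λ x → joint x ≤ R} {λ m → wP m < K} e F
        (λ {m} m+e≤R → +-cancelʳ-< (dot W e) (wP m) K (ℕ.≤-<-trans m+e≤R R<K+e)) F≤R

    ⊗-coeffX-Below : ∀ {R k K} x e F → Homogeneous k x → J.AtMost R F → k + R < K + dot W e →
                     Below K (x ⊗' coeffX e F)
    ⊗-coeffX-Below {R} {k} {K} x e F x≡k F≤R k+R<K+e =
      Weights-⊛ {_≡ k} {λ b → b + dot W e ≤ R} {_< K}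
        (λ {a} {b} a≡k b+e≤R → +-cancelʳ-< (dot W e) (a + b) K (begin-strict
          a + b + dot W e   ≡⟨ ℕ.+-assoc a b (dot W e) ⟩
          a + (b + dot W e) ≤⟨ ℕ.+-mono-≤ (ℕ.≤-reflexive a≡k) b+e≤R ⟩
          k + R             <⟨ k+R<K+e ⟩
          K + dot W e       ∎))
        x≡k (coeffX-All e F (λ m+e≤R → m+e≤R) F≤R)
      where open ℕ.≤-Reasoning

    entry-Below : ∀ {R k K} F e₁ x e₂ → J.AtMost R F → Homogeneous k x →
                  R < K + dot W e₁ → k + R < K + dot W e₂ → Below K (entry F e₁ x e₂)
    entry-Below F e₁ x e₂ F≤R x≡k first second =
      ++⁺ (coeffX-Below e₁ F F≤R first) (map⁺ (⊗-coeffX-Below x e₂ F x≡k F≤R second))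

    entry-Homogeneous : ∀ {R k K} F e₁ x e₂ → J.Homogeneous R F → Homogeneous k x →
                        R ≡ K + dot W e₁ → k + R ≡ K + dot W e₂ → Homogeneous K (entry F e₁ x e₂)
    entry-Homogeneous {R} {k} {K} F e₁ x e₂ F≡R x≡k first second =
      ++⁺ (coeffX-All e₁ F (λ {m} m+e≡R → +-cancelʳ-≡ (dot W e₁) (wP m) K (trans m+e≡R first)) F≡R)
          (map⁺ (Weights-⊛ {_≡ k} {λ b → b + dot W e₂ ≡ R} {_≡ K}
            (λ {a} {b} a≡k b+e≡R → +-cancelʳ-≡ (dot W e₂) (a + b) K (begin
              a + b + dot W e₂   ≡⟨ ℕ.+-assoc a b (dot W e₂) ⟩
              a + (b + dot W e₂) ≡⟨ cong₂ _+_ a≡k b+e≡R ⟩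
              k + R              ≡⟨ second ⟩
              K + dot W e₂       ∎))
            x≡k (coeffX-All e₂ F (λ m+e≡R → m+e≡R) F≡R)))
      where open ≡-Reasoning

    entry-Leads : ∀ {m k} F e₁ x e₂ → J.Leads (m , e₁) F → Homogeneous k x → k + dot W e₁ < dot W e₂ →
                  Leads m (entry F e₁ x e₂) ×
                  weightCoeff (wP m) (entry F e₁ x e₂) ≡ J.weightCoeff (joint (m , e₁)) F
    entry-Leads {m} {k} F e₁ x e₂ F-lead x≡k k+e₁<e₂ =
      Leads-⊖-Below (coeffX-Leads F F-lead) tail-Below ,
      trans (weightCoeff-⊖-Below (coeffX e₁ F) tail-Below) (weightCoeff-coeffX F F-lead)
      where
      tail-Below : Below (wP m) (x ⊗' coeffX e₂ F)
      tail-Below = ⊗-coeffX-Below x e₂ F x≡k (J.Leads⇒AtMost F-lead) (+-monoʳ-<-shift k (wP m) k+e₁<e₂)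

  det3-Homogeneous : ∀ q K (M : Fin 3 → Fin 3 → PPoly) → (∀ i j → Homogeneous K (M i j)) →
                     Homogeneous (K + (K + K)) (HW.det3 q M)
  det3-Homogeneous q K M hom =
    ++⁺ (++⁺ (Homogeneous-⊛ (hom (# 0) (# 0)) (minor (# 1) (# 1) (# 2) (# 2) (# 1) (# 2) (# 2) (# 1)))
             (map⁺ (Homogeneous-⊛ (hom (# 0) (# 1)) (minor (# 1) (# 0) (# 2) (# 2) (# 1) (# 2) (# 2) (# 0)))))
        (Homogeneous-⊛ (hom (# 0) (# 2)) (minor (# 1) (# 0) (# 2) (# 1) (# 1) (# 1) (# 2) (# 0)))
    where
    minor : ∀ i j k l i' j' k' l' → Homogeneous (K + K) (M i j ⊗' M k l ⊖' M i' j' ⊗' M k' l')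
    minor i j k l i' j' k' l' =
      ++⁺ (Homogeneous-⊛ (hom i j) (hom k l)) (map⁺ (Homogeneous-⊛ (hom i' j') (hom k' l')))

  det3-nonIdentity-Below : ∀ (M : Fin 3 → Fin 3 → PPoly) (u v : Fin 3 → ℕ) →
    (∀ i → AtMost (u i + v i) (M i i)) → (∀ i j → i ≢ j → Below (u i + v j) (M i j)) →
    let Λ = (u (# 0) + v (# 0)) + ((u (# 1) + v (# 1)) + (u (# 2) + v (# 2))) in
    Below ((u (# 1) + v (# 1)) + (u (# 2) + v (# 2))) (M (# 1) (# 2) ⊗' M (# 2) (# 1)) ×
    Below Λ (M (# 0) (# 1) ⊗' (M (# 1) (# 0) ⊗' M (# 2) (# 2) ⊖' M (# 1) (# 2) ⊗' M (# 2) (# 0))) ×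
    Below Λ (M (# 0) (# 2) ⊗' (M (# 1) (# 0) ⊗' M (# 2) (# 1) ⊖' M (# 1) (# 1) ⊗' M (# 2) (# 0)))
  det3-nonIdentity-Below M u v diag off =
    Below-≡ (exchange u₁ v₂ u₂ v₁) (Below-⊛ (off (# 1) (# 2) λ ()) (off≤ (# 2) (# 1) λ ())) ,
    Below-≡ (exchange-outer u₀ v₁ u₁ v₀ (u₂ + v₂))
      (Below-⊛ (off (# 0) (# 1) λ ())
        (++⁺ (AtMost-⊛ (off≤ (# 1) (# 0) λ ()) (diag (# 2)))
             (map⁺ (AtMost-≡ (exchange u₁ v₂ u₂ v₀)
                     (AtMost-⊛ (off≤ (# 1) (# 2) λ ()) (off≤ (# 2) (# 0) λ ())))))) ,
    Below-≡ (rotate u₀ v₂ u₁ v₀ u₂ v₁)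
      (Below-⊛ (off (# 0) (# 2) λ ())
        (++⁺ (AtMost-⊛ (off≤ (# 1) (# 0) λ ()) (off≤ (# 2) (# 1) λ ()))
             (map⁺ (AtMost-≡ (exchange u₁ v₁ u₂ v₀) (AtMost-⊛ (diag (# 1)) (off≤ (# 2) (# 0) λ ()))))))
    where
    u₀ u₁ u₂ v₀ v₁ v₂ : ℕ
    u₀ = u (# 0); u₁ = u (# 1); u₂ = u (# 2)
    v₀ = v (# 0); v₁ = v (# 1); v₂ = v (# 2)

    off≤ : ∀ i j → i ≢ j → AtMost (u i + v j) (M i j)
    off≤ i j i≢j = Below⇒AtMost (off i j i≢j)

    exchange : ∀ a b c d → (a + b) + (c + d) ≡ (a + d) + (c + b)
    exchange = solve-∀
    exchange-outer : ∀ a b c d e → (a + b) + ((c + d) + e) ≡ (a + d) + ((c + b) + e)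
    exchange-outer = solve-∀
    rotate : ∀ a b c d e f → (a + b) + ((c + d) + (e + f)) ≡ (a + d) + ((c + f) + (e + b))
    rotate = solve-∀

  det3-Leads : ∀ q (M : Fin 3 → Fin 3 → PPoly) (lead : Fin 3 → PMon) (u v : Fin 3 → ℕ) →
    (∀ i → Leads (lead i) (M i i)) → (∀ i → wP (lead i) ≡ u i + v i) →
    (∀ i j → i ≢ j → Below (u i + v j) (M i j)) →
    Leads (lead (# 0) ·P (lead (# 1) ·P lead (# 2))) (HW.det3 q M) ×
    weightCoeff (wP (lead (# 0) ·P (lead (# 1) ·P lead (# 2)))) (HW.det3 q M) ≡
      weightCoeff (wP (lead (# 0))) (M (# 0) (# 0)) ℤ.*
      (weightCoeff (wP (lead (# 1))) (M (# 1) (# 1)) ℤ.* weightCoeff (wP (lead (# 2))) (M (# 2) (# 2)))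
  det3-Leads q M lead u v diag diag-weight off =
    Leads-++-Below (proj₁ leading₀₁₂) part₃-Below ,
    trans (weightCoeff-++-Below firstTwoTerms part₃-Below)
          (trans (proj₂ leading₀₁₂)
                 (cong (ℤ._*_ (weightCoeff (wP (lead (# 0))) (M (# 0) (# 0)))) (proj₂ leading₁₂)))
    where
    weight₁₂ : wP (lead (# 1) ·P lead (# 2)) ≡ (u (# 1) + v (# 1)) + (u (# 2) + v (# 2))
    weight₁₂ = trans (wP-· (lead (# 1)) _) (cong₂ _+_ (diag-weight (# 1)) (diag-weight (# 2)))

    weight₀₁₂ : wP (lead (# 0) ·P (lead (# 1) ·P lead (# 2))) ≡
                (u (# 0) + v (# 0)) + ((u (# 1) + v (# 1)) + (u (# 2) + v (# 2)))
    weight₀₁₂ = trans (wP-· (lead (# 0)) _) (cong₂ _+_ (diag-weight (# 0)) weight₁₂)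

    nonIdentity = det3-nonIdentity-Below M u v (λ i → AtMost-≡ (diag-weight i) (Leads⇒AtMost (diag i))) off
    leading₁₂ = Leads-⊛-⊖-Below (diag (# 1)) (diag (# 2)) (Below-≡ (sym weight₁₂) (proj₁ nonIdentity))
    leading₀₁₂ = Leads-⊛-⊖-Below (diag (# 0)) (proj₁ leading₁₂)
                                 (Below-≡ (sym weight₀₁₂) (proj₁ (proj₂ nonIdentity)))
    part₃-Below = Below-≡ (sym weight₀₁₂) (proj₂ (proj₂ nonIdentity))

    firstTwoTerms : PPoly
    firstTwoTerms = M (# 0) (# 0) ⊗' (M (# 1) (# 1) ⊗' M (# 2) (# 2) ⊖' M (# 1) (# 2) ⊗' M (# 2) (# 1))
                 ⊖' M (# 0) (# 1) ⊗' (M (# 1) (# 0) ⊗' M (# 2) (# 2) ⊖' M (# 1) (# 2) ⊗' M (# 2) (# 0))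

data Linear : Set where
  _·s+_ : ℕ → ℕ → Linear

⟦_⟧ : Linear → ℕ → ℕ
⟦ a ·s+ b ⟧ s = a * s + b

⟦_⟧ᵥ : ∀ {n} → Vec Linear n → ℕ → Vec ℕ n
⟦ xs ⟧ᵥ s = Vec.map (λ x → ⟦ x ⟧ s) xs

infixl 6 _+ₗ_
_+ₗ_ : Linear → Linear → Linear
(a ·s+ b) +ₗ (c ·s+ d) = (a + c) ·s+ (b + d)

_*ₗ_ : ℕ → Linear → Linear
k *ₗ (a ·s+ b) = (k * a) ·s+ (k * b)

dotₗ : ∀ {n} → Vec ℕ n → Vec Linear n → Linear
dotₗ []      []       = 0 ·s+ 0
dotₗ (k ∷ u) (x ∷ xs) = k *ₗ x +ₗ dotₗ u xs

infix 4 _<ₗ_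
_<ₗ_ : Linear → Linear → Set
(a ·s+ b) <ₗ (c ·s+ d) = a ≤ c × b < d

_<ₗ?_ : ∀ x y → Dec (x <ₗ y)
(a ·s+ b) <ₗ? (c ·s+ d) = (a ≤? c) ×-dec (b <? d)

_≟ₗ_ : ∀ (x y : Linear) → Dec (x ≡ y)
(a ·s+ b) ≟ₗ (c ·s+ d) = map′ (λ (a≡c , b≡d) → cong₂ _·s+_ a≡c b≡d)
                              (λ { refl → refl , refl }) ((a ≟ c) ×-dec (b ≟ d))

⟦+ₗ⟧ : ∀ x y s → ⟦ x +ₗ y ⟧ s ≡ ⟦ x ⟧ s + ⟦ y ⟧ s
⟦+ₗ⟧ (a ·s+ b) (c ·s+ d) s = lemma a b c d s
  where
  lemma : ∀ a b c d s → (a + c) * s + (b + d) ≡ (a * s + b) + (c * s + d)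
  lemma = solve-∀

⟦*ₗ⟧ : ∀ k x s → ⟦ k *ₗ x ⟧ s ≡ k * ⟦ x ⟧ s
⟦*ₗ⟧ k (a ·s+ b) s = lemma k a b s
  where
  lemma : ∀ k a b s → k * a * s + k * b ≡ k * (a * s + b)
  lemma = solve-∀

⟦dotₗ⟧ : ∀ {n} (u : Vec ℕ n) (xs : Vec Linear n) s → dot u (⟦ xs ⟧ᵥ s) ≡ ⟦ dotₗ u xs ⟧ s
⟦dotₗ⟧ []      []       s = refl
⟦dotₗ⟧ (k ∷ u) (x ∷ xs) s = begin
  k * ⟦ x ⟧ s + dot u (⟦ xs ⟧ᵥ s) ≡⟨ cong₂ _+_ (sym (⟦*ₗ⟧ k x s)) (⟦dotₗ⟧ u xs s) ⟩
  ⟦ k *ₗ x ⟧ s + ⟦ dotₗ u xs ⟧ s           ≡⟨ ⟦+ₗ⟧ (k *ₗ x) (dotₗ u xs) s ⟨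
  ⟦ k *ₗ x +ₗ dotₗ u xs ⟧ s                ∎
  where open ≡-Reasoning

<ₗ-sound : ∀ {x y} s → x <ₗ y → ⟦ x ⟧ s < ⟦ y ⟧ s
<ₗ-sound {a ·s+ b} {c ·s+ d} s (a≤c , b<d) = ℕ.+-mono-≤-< (ℕ.*-monoˡ-≤ s a≤c) b<d

suc*≡⟦⟧ : ∀ k s → suc s * k ≡ ⟦ k ·s+ k ⟧ s
suc*≡⟦⟧ k s = lemma k s
  where
  lemma : ∀ k s → suc s * k ≡ k * s + k
  lemma = solve-∀

module Degree = Coefficients Vec.sum sum-zipWith refl

x4Only : Vec ℕ 4
x4Only = 0 ∷ 0 ∷ 0 ∷ 1 ∷ []

module DegreeX4 = Degree.Joint x4Only

vκ-Homogeneous : DegreeX4.J.Homogeneous 3 (v ⊗ κ)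
vκ-Homogeneous = toWitness {a? = All.all? (λ t → DegreeX4.joint (proj₁ t) ≟ 3) (v ⊗ κ)} _

paramWeights : Vec ℕ 10
paramWeights = 10 ∷ 0 ∷ 10 ∷ 0 ∷ 19 ∷ 28 ∷ 29 ∷ 28 ∷ 19 ∷ 0 ∷ []

module Weight = Coefficients (dot paramWeights) (dot-zipWith paramWeights) (dot-replicate-0 paramWeights)

xWeights : Fin 3 → Vec ℕ 4
xWeights zero             = 10 ∷ 15 ∷ 0 ∷ 24 ∷ []
xWeights (suc zero)       = 0 ∷ 13 ∷ 0 ∷ 17 ∷ []
xWeights (suc (suc zero)) = 0 ∷ 15 ∷ 10 ∷ 24 ∷ []

-- The terms −4 d₁d₄ X₁²X₂X₃X₄, −4 d₁d₅ X₁X₂²X₃X₄ and −4 d₂d₅ X₁X₂X₃²X₄ of X₄·K₀.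
leadingMonomial : Fin 3 → PMon × XMon
leadingMonomial zero             = (0 ∷ 0 ∷ 0 ∷ 0 ∷ 1 ∷ 0 ∷ 0 ∷ 1 ∷ 0 ∷ 0 ∷ []) , (2 ∷ 1 ∷ 1 ∷ 1 ∷ [])
leadingMonomial (suc zero)       = (0 ∷ 0 ∷ 0 ∷ 0 ∷ 1 ∷ 0 ∷ 0 ∷ 0 ∷ 1 ∷ 0 ∷ []) , (1 ∷ 2 ∷ 1 ∷ 1 ∷ [])
leadingMonomial (suc (suc zero)) = (0 ∷ 0 ∷ 0 ∷ 0 ∷ 0 ∷ 1 ∷ 0 ∷ 0 ∷ 1 ∷ 0 ∷ []) , (1 ∷ 1 ∷ 2 ∷ 1 ∷ [])

module Column (j : Fin 3) = Weight.Joint (xWeights j)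

vκ-Leads : ∀ j → Column.J.Leads j (leadingMonomial j) (v ⊗ κ)
vκ-Leads = toWitness {a? = Fin.all? λ j → All.all? (λ t →
  let open Column j; x = proj₁ t; m = leadingMonomial j in
  (joint x ≤? joint m) ×-dec
  ((joint x ≟ joint m) →-dec ×-≡-dec (vec≡-dec ℕ._≟_) (vec≡-dec ℕ._≟_) x m)) (v ⊗ κ)} _

vκ-leadingCoeff : ∀ j → Column.J.weightCoeff j (Column.joint j (leadingMonomial j)) (v ⊗ κ) ≡ -[1+ 3 ]
vκ-leadingCoeff zero             = refl
vκ-leadingCoeff (suc zero)       = refl
vκ-leadingCoeff (suc (suc zero)) = refl

zipWith-+-map-* : ∀ {k} n (e : Vec ℕ k) → zipWith _+_ e (Vec.map (n *_) e) ≡ Vec.map (suc n *_) e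
zipWith-+-map-* n []      = refl
zipWith-+-map-* n (x ∷ e) = cong (x + n * x ∷_) (zipWith-+-map-* n e)

_^P_ : PMon → ℕ → PMon
_^P_ = monoidPow _·P_ oneP

_^PX_ : PMon × XMon → ℕ → PMon × XMon
_^PX_ = monoidPow _·PX_ (oneP , oneX)

^PX≡^P,* : ∀ μ e n → (μ , e) ^PX n ≡ (μ ^P n , Vec.map (n *_) e)
^PX≡^P,* μ e zero    = cong (oneP ,_) (sym (map-const e 0))
^PX≡^P,* μ e (suc n) rewrite ^PX≡^P,* μ e n = cong (μ ·P (μ ^P n) ,_) (zipWith-+-map-* n e)

data Exponent : Set where
  p-2 p-1 2p-2 2p-1 : Exponent

value : ℕ → Exponent → ℕ
value p p-2  = p ∸ 2
value p p-1  = p ∸ 1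
value p 2p-2 = 2 * p ∸ 2
value p 2p-1 = 2 * p ∸ 1

exponents : ℕ → Vec Exponent 4 → XMon
exponents p = Vec.map (value p)

firstExponents : Fin 3 → Fin 3 → Vec Exponent 4
firstExponents zero             zero             = 2p-2 ∷ p-1  ∷ p-1  ∷ p-1 ∷ []
firstExponents zero             (suc zero)       = p-2  ∷ 2p-1 ∷ p-1  ∷ p-1 ∷ []
firstExponents zero             (suc (suc zero)) = p-2  ∷ p-1  ∷ 2p-1 ∷ p-1 ∷ []
firstExponents (suc zero)       zero             = 2p-1 ∷ p-2  ∷ p-1  ∷ p-1 ∷ []
firstExponents (suc zero)       (suc zero)       = p-1  ∷ 2p-2 ∷ p-1  ∷ p-1 ∷ []
firstExponents (suc zero)       (suc (suc zero)) = p-1  ∷ p-2  ∷ 2p-1 ∷ p-1 ∷ []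
firstExponents (suc (suc zero)) zero             = 2p-1 ∷ p-1  ∷ p-2  ∷ p-1 ∷ []
firstExponents (suc (suc zero)) (suc zero)       = p-1  ∷ 2p-1 ∷ p-2  ∷ p-1 ∷ []
firstExponents (suc (suc zero)) (suc (suc zero)) = p-1  ∷ p-1  ∷ 2p-2 ∷ p-1 ∷ []

secondExponents : Fin 3 → Vec Exponent 4
secondExponents zero             = p-2 ∷ p-1 ∷ p-1 ∷ 2p-1 ∷ []
secondExponents (suc zero)       = p-1 ∷ p-2 ∷ p-1 ∷ 2p-1 ∷ []
secondExponents (suc (suc zero)) = p-1 ∷ p-1 ∷ p-2 ∷ 2p-1 ∷ []

planeCoeff : Fin 3 → PPoly
planeCoeff zero             = a'
planeCoeff (suc zero)       = b'
planeCoeff (suc (suc zero)) = c'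

H-entry : ∀ p i j → HW.H p i j ≡
  entry (HW.F p) (exponents p (firstExponents i j)) (planeCoeff j ^' p) (exponents p (secondExponents i))
H-entry p zero             zero             = refl
H-entry p zero             (suc zero)       = refl
H-entry p zero             (suc (suc zero)) = refl
H-entry p (suc zero)       zero             = refl
H-entry p (suc zero)       (suc zero)       = refl
H-entry p (suc zero)       (suc (suc zero)) = refl
H-entry p (suc (suc zero)) zero             = refl
H-entry p (suc (suc zero)) (suc zero)       = refl
H-entry p (suc (suc zero)) (suc (suc zero)) = refl

linear : Exponent → Linear
linear p-2  = 1 ·s+ 0
linear p-1  = 1 ·s+ 1
linear 2p-2 = 2 ·s+ 2
linear 2p-1 = 2 ·s+ 3

value-linear : ∀ s x → value (2 + s) x ≡ ⟦ linear x ⟧ s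
value-linear s p-2  = lemma s where
  lemma : ∀ s → s ≡ 1 * s + 0
  lemma = solve-∀
value-linear s p-1  = lemma s where
  lemma : ∀ s → suc s ≡ 1 * s + 1
  lemma = solve-∀
value-linear s 2p-2 = cong (_∸ 2) (lemma s) where
  lemma : ∀ s → 2 * (2 + s) ≡ 2 + (2 * s + 2)
  lemma = solve-∀
value-linear s 2p-1 = cong (_∸ 1) (lemma s) where
  lemma : ∀ s → 2 * (2 + s) ≡ 1 + (2 * s + 3)
  lemma = solve-∀

planeCoeffWeight : Fin 3 → ℕ
planeCoeffWeight j = Vec.lookup paramWeights (j ↑ˡ 7)

planeCoeff-Homogeneous : ∀ j → Weight.Homogeneous (planeCoeffWeight j) (planeCoeff j)
planeCoeff-Homogeneous zero             = refl ∷ []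
planeCoeff-Homogeneous (suc zero)       = refl ∷ []
planeCoeff-Homogeneous (suc (suc zero)) = refl ∷ []

planeCoeff-degree : ∀ j → Degree.Homogeneous 1 (planeCoeff j)
planeCoeff-degree zero             = refl ∷ []
planeCoeff-degree (suc zero)       = refl ∷ []
planeCoeff-degree (suc (suc zero)) = refl ∷ []

rowPotential columnPotential : Fin 3 → Linear
rowPotential zero             = 0 ·s+ 0
rowPotential (suc zero)       = 0 ·s+ 6
rowPotential (suc (suc zero)) = 0 ·s+ 0
columnPotential zero             = 47 ·s+ 47
columnPotential (suc zero)       = 38 ·s+ 32
columnPotential (suc (suc zero)) = 47 ·s+ 47

xWeightₗ : Vec ℕ 4 → Vec Exponent 4 → Linear
xWeightₗ W xs = dotₗ W (Vec.map linear xs)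

FWeightₗ : Fin 3 → Linear
FWeightₗ j = let ω = Column.joint j (leadingMonomial j) in ω ·s+ ω

planeCoeffPowerWeightₗ : Fin 3 → Linear
planeCoeffPowerWeightₗ j = planeCoeffWeight j ·s+ (2 * planeCoeffWeight j)

boundₗ : Fin 3 → Fin 3 → Linear
boundₗ i j = rowPotential i +ₗ columnPotential j

leadingParamWeight : Fin 3 → ℕ
leadingParamWeight j = dot paramWeights (proj₁ (leadingMonomial j))

offDiagonal-certificate : ∀ i j → i ≢ j →
  FWeightₗ j <ₗ boundₗ i j +ₗ xWeightₗ (xWeights j) (firstExponents i j) ×
  planeCoeffPowerWeightₗ j +ₗ FWeightₗ j <ₗ boundₗ i j +ₗ xWeightₗ (xWeights j) (secondExponents i)
offDiagonal-certificate = toWitness {a? = Fin.all? λ i → Fin.all? λ j → ¬? (i Fin.≟ j) →-dec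
  ((FWeightₗ j <ₗ? (boundₗ i j +ₗ xWeightₗ (xWeights j) (firstExponents i j))) ×-dec
   ((planeCoeffPowerWeightₗ j +ₗ FWeightₗ j) <ₗ? (boundₗ i j +ₗ xWeightₗ (xWeights j) (secondExponents i))))} _

diagonal-certificate : ∀ j →
  planeCoeffPowerWeightₗ j +ₗ xWeightₗ (xWeights j) (firstExponents j j) <ₗ xWeightₗ (xWeights j) (secondExponents j) ×
  boundₗ j j ≡ leadingParamWeight j ·s+ leadingParamWeight j ×
  Vec.map linear (firstExponents j j) ≡ Vec.map (λ k → k ·s+ k) (proj₂ (leadingMonomial j))
diagonal-certificate = toWitness {a? = Fin.all? λ j →
  ((planeCoeffPowerWeightₗ j +ₗ xWeightₗ (xWeights j) (firstExponents j j))
     <ₗ? xWeightₗ (xWeights j) (secondExponents j)) ×-dec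
  (boundₗ j j ≟ₗ _) ×-dec vec≡-dec _≟ₗ_ _ _} _

degree-certificate : ∀ i j →
  3 ·s+ 3 ≡ 2 ·s+ 2 +ₗ xWeightₗ x4Only (firstExponents i j) ×
  1 ·s+ 2 +ₗ 3 ·s+ 3 ≡ 2 ·s+ 2 +ₗ xWeightₗ x4Only (secondExponents i)
degree-certificate = toWitness {a? = Fin.all? λ i → Fin.all? λ j →
  (_ ≟ₗ _) ×-dec (_ ≟ₗ _)} _

module AtPrime (s : ℕ) where

  p r : ℕ
  p = 2 + s
  r = 1 + s

  F : Poly
  F = HW.F p

  H : Fin 3 → Fin 3 → PPoly
  H = HW.H p

  exponents-linear : ∀ xs → exponents p xs ≡ ⟦ Vec.map linear xs ⟧ᵥ s
  exponents-linear xs = trans (map-cong (value-linear s) xs) (map-∘ (λ x → ⟦ x ⟧ s) linear xs)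

  ⟦xWeightₗ⟧ : ∀ W xs → ⟦ xWeightₗ W xs ⟧ s ≡ dot W (exponents p xs)
  ⟦xWeightₗ⟧ W xs = trans (sym (⟦dotₗ⟧ W (Vec.map linear xs) s)) (cong (dot W) (sym (exponents-linear xs)))

  ⟦+xWeightₗ⟧ : ∀ K W xs → ⟦ K +ₗ xWeightₗ W xs ⟧ s ≡ ⟦ K ⟧ s + dot W (exponents p xs)
  ⟦+xWeightₗ⟧ K W xs = trans (⟦+ₗ⟧ K (xWeightₗ W xs) s) (cong (⟦ K ⟧ s +_) (⟦xWeightₗ⟧ W xs))

  evaluate-≡ : ∀ {x K} W xs → x ≡ K +ₗ xWeightₗ W xs → ⟦ x ⟧ s ≡ ⟦ K ⟧ s + dot W (exponents p xs)
  evaluate-≡ {K = K} W xs eq = trans (cong (λ x → ⟦ x ⟧ s) eq) (⟦+xWeightₗ⟧ K W xs)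

  evaluate-< : ∀ {x K} W xs → x <ₗ K +ₗ xWeightₗ W xs → ⟦ x ⟧ s < ⟦ K ⟧ s + dot W (exponents p xs)
  evaluate-< {x} {K} W xs lt = subst (⟦ x ⟧ s <_) (⟦+xWeightₗ⟧ K W xs) (<ₗ-sound s lt)

  evaluate-+-< : ∀ {x y K} W xs → x +ₗ y <ₗ K +ₗ xWeightₗ W xs →
                 ⟦ x ⟧ s + ⟦ y ⟧ s < ⟦ K ⟧ s + dot W (exponents p xs)
  evaluate-+-< {x} {y} {K} W xs lt = subst (_< ⟦ K ⟧ s + dot W (exponents p xs)) (⟦+ₗ⟧ x y s) (evaluate-< W xs lt)

  p*≡⟦⟧ : ∀ k → p * k ≡ ⟦ k ·s+ (2 * k) ⟧ s
  p*≡⟦⟧ k = lemma k s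
    where
    lemma : ∀ k s → (2 + s) * k ≡ k * s + 2 * k
    lemma = solve-∀

  F-Homogeneous : DegreeX4.J.Homogeneous (r * 3) F
  F-Homogeneous = DegreeX4.J.Homogeneous-^ r vκ-Homogeneous

  H-Homogeneous : ∀ i j → Degree.Homogeneous (⟦ 2 ·s+ 2 ⟧ s) (H i j)
  H-Homogeneous i j = subst (Degree.Homogeneous _) (sym (H-entry p i j))
    (DegreeX4.entry-Homogeneous F _ (planeCoeff j ^' p) _ F-Homogeneous (Degree.Homogeneous-^ p (planeCoeff-degree j))
      (trans (suc*≡⟦⟧ 3 s) (evaluate-≡ x4Only (firstExponents i j) first))
      (trans (cong₂ _+_ (p*≡⟦⟧ 1) (suc*≡⟦⟧ 3 s))
        (trans (sym (⟦+ₗ⟧ (1 ·s+ 2) (3 ·s+ 3) s)) (evaluate-≡ x4Only (secondExponents i) second))))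
    where
    first  = proj₁ (degree-certificate i j)
    second = proj₂ (degree-certificate i j)

  F-Leads : ∀ j → Column.J.Leads j (leadingMonomial j ^PX r) F
  F-Leads j = Column.J.Leads-^ j r (vκ-Leads j)

  F-AtMost : ∀ j → Column.J.AtMost j (⟦ FWeightₗ j ⟧ s) F
  F-AtMost j = Column.J.AtMost-≡ j (trans (Column.J.w-^ₘ j _ r) (suc*≡⟦⟧ _ s)) (Column.J.Leads⇒AtMost j (F-Leads j))

  planeCoeffPower-Homogeneous : ∀ j → Weight.Homogeneous (⟦ planeCoeffPowerWeightₗ j ⟧ s) (planeCoeff j ^' p)
  planeCoeffPower-Homogeneous j =
    Weight.Homogeneous-≡ (p*≡⟦⟧ (planeCoeffWeight j)) (Weight.Homogeneous-^ p (planeCoeff-Homogeneous j))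

  H-Below : ∀ i j → i ≢ j → Weight.Below (⟦ rowPotential i ⟧ s + ⟦ columnPotential j ⟧ s) (H i j)
  H-Below i j i≢j = subst (Weight.Below _) (sym (H-entry p i j))
    (Weight.Below-≡ (⟦+ₗ⟧ (rowPotential i) (columnPotential j) s)
      (Column.entry-Below j F _ (planeCoeff j ^' p) _ (F-AtMost j) (planeCoeffPower-Homogeneous j)
        (evaluate-< (xWeights j) (firstExponents i j) first)
        (evaluate-+-< {planeCoeffPowerWeightₗ j} {FWeightₗ j} (xWeights j) (secondExponents i) second)))
    where
    first  = proj₁ (offDiagonal-certificate i j i≢j)
    second = proj₂ (offDiagonal-certificate i j i≢j)

  diagonalMonomial : Fin 3 → PMon
  diagonalMonomial j = proj₁ (leadingMonomial j) ^P r

  F-leadingMonomial : ∀ j → leadingMonomial j ^PX r ≡ (diagonalMonomial j , exponents p (firstExponents j j))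
  F-leadingMonomial j = trans (^PX≡^P,* μ e r) (cong (μ ^P r ,_) (begin
    Vec.map (r *_) e                             ≡⟨ map-cong (λ k → suc*≡⟦⟧ k s) e ⟩
    Vec.map (λ k → ⟦ k ·s+ k ⟧ s) e              ≡⟨ map-∘ (λ x → ⟦ x ⟧ s) (λ k → k ·s+ k) e ⟩
    ⟦ Vec.map (λ k → k ·s+ k) e ⟧ᵥ s             ≡⟨ cong (λ xs → ⟦ xs ⟧ᵥ s) (proj₂ (proj₂ (diagonal-certificate j))) ⟨
    ⟦ Vec.map linear (firstExponents j j) ⟧ᵥ s   ≡⟨ exponents-linear (firstExponents j j) ⟨
    exponents p (firstExponents j j)             ∎))
    where
    open ≡-Reasoning
    μ = proj₁ (leadingMonomial j)
    e = proj₂ (leadingMonomial j)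

  F-weightCoeff : ∀ j → Column.J.weightCoeff j (Column.joint j (leadingMonomial j ^PX r)) F ≡ -[1+ 3 ] ℤ.^ r
  F-weightCoeff j = begin
    Column.J.weightCoeff j (Column.joint j (leadingMonomial j ^PX r)) F
      ≡⟨ cong (λ K → Column.J.weightCoeff j K F) (Column.J.w-^ₘ j (leadingMonomial j) r) ⟩
    Column.J.weightCoeff j (r * Column.joint j (leadingMonomial j)) F
      ≡⟨ Column.J.weightCoeff-^ j r (Column.J.Leads⇒AtMost j (vκ-Leads j)) ⟩
    Column.J.weightCoeff j (Column.joint j (leadingMonomial j)) (v ⊗ κ) ℤ.^ r
      ≡⟨ cong (ℤ._^ r) (vκ-leadingCoeff j) ⟩
    -[1+ 3 ] ℤ.^ r ∎
    where open ≡-Reasoning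

  diagonalMonomial-weight : ∀ j →
    dot paramWeights (diagonalMonomial j) ≡ ⟦ rowPotential j ⟧ s + ⟦ columnPotential j ⟧ s
  diagonalMonomial-weight j = begin
    dot paramWeights (proj₁ (leadingMonomial j) ^P r)  ≡⟨ Weight.w-^ₘ (proj₁ (leadingMonomial j)) r ⟩
    r * dot paramWeights (proj₁ (leadingMonomial j))   ≡⟨ suc*≡⟦⟧ _ s ⟩
    ⟦ leadingParamWeight j ·s+ leadingParamWeight j ⟧ s ≡⟨ cong (λ x → ⟦ x ⟧ s) (proj₁ (proj₂ (diagonal-certificate j))) ⟨
    ⟦ boundₗ j j ⟧ s                                   ≡⟨ ⟦+ₗ⟧ (rowPotential j) (columnPotential j) s ⟩
    ⟦ rowPotential j ⟧ s + ⟦ columnPotential j ⟧ s     ∎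
    where open ≡-Reasoning

  H-Leads : ∀ j → Weight.Leads (diagonalMonomial j) (H j j) ×
                  Weight.weightCoeff (dot paramWeights (diagonalMonomial j)) (H j j) ≡ -[1+ 3 ] ℤ.^ r
  H-Leads j = subst (λ X → Weight.Leads (diagonalMonomial j) X ×
                           Weight.weightCoeff (dot paramWeights (diagonalMonomial j)) X ≡ -[1+ 3 ] ℤ.^ r)
                    (sym (H-entry p j j))
                    (proj₁ entry-leads , trans (proj₂ entry-leads) F-coeff)
    where
    e₁ e₂ : XMon
    e₁ = exponents p (firstExponents j j)
    e₂ = exponents p (secondExponents j)

    F-Leads′ : Column.J.Leads j (diagonalMonomial j , e₁) F
    F-Leads′ = subst (λ m → Column.J.Leads j m F) (F-leadingMonomial j) (F-Leads j)

    F-coeff : Column.J.weightCoeff j (Column.joint j (diagonalMonomial j , e₁)) F ≡ -[1+ 3 ] ℤ.^ r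
    F-coeff = trans (cong (λ m → Column.J.weightCoeff j (Column.joint j m) F) (sym (F-leadingMonomial j)))
                    (F-weightCoeff j)

    xWeight< : ⟦ planeCoeffPowerWeightₗ j ⟧ s + dot (xWeights j) e₁ < dot (xWeights j) e₂
    xWeight< = subst₂ _<_ (⟦+xWeightₗ⟧ (planeCoeffPowerWeightₗ j) (xWeights j) (firstExponents j j))
                         (⟦xWeightₗ⟧ (xWeights j) (secondExponents j))
                         (<ₗ-sound s (proj₁ (diagonal-certificate j)))

    entry-leads : Weight.Leads (diagonalMonomial j) (entry F e₁ (planeCoeff j ^' p) e₂) ×
                  Weight.weightCoeff (dot paramWeights (diagonalMonomial j)) (entry F e₁ (planeCoeff j ^' p) e₂) ≡
                  Column.J.weightCoeff j (Column.joint j (diagonalMonomial j , e₁)) F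
    entry-leads = Column.entry-Leads j F e₁ (planeCoeff j ^' p) e₂ F-Leads′ (planeCoeffPower-Homogeneous j) xWeight<

  detLeadingMonomial : PMon
  detLeadingMonomial = diagonalMonomial (# 0) ·P (diagonalMonomial (# 1) ·P diagonalMonomial (# 2))

  coeffP-detLeadingMonomial : coeffP detLeadingMonomial (detHX p) ≡ -[1+ 3 ] ℤ.^ (r + (r + r))
  coeffP-detLeadingMonomial = begin
    coeffP detLeadingMonomial (detHX p)
      ≡⟨ Weight.coeffP-Leads (detHX p) (proj₁ det-leads) ⟩
    Weight.weightCoeff (dot paramWeights detLeadingMonomial) (detHX p)
      ≡⟨ proj₂ det-leads ⟩
    diagCoeff (# 0) ℤ.* (diagCoeff (# 1) ℤ.* diagCoeff (# 2))
      ≡⟨ cong₂ ℤ._*_ (proj₂ (H-Leads (# 0))) (cong₂ ℤ._*_ (proj₂ (H-Leads (# 1))) (proj₂ (H-Leads (# 2)))) ⟩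
    -[1+ 3 ] ℤ.^ r ℤ.* (-[1+ 3 ] ℤ.^ r ℤ.* -[1+ 3 ] ℤ.^ r)
      ≡⟨ cong (-[1+ 3 ] ℤ.^ r ℤ.*_) (ℤ.^-distribˡ-+-* -[1+ 3 ] r r) ⟨
    -[1+ 3 ] ℤ.^ r ℤ.* -[1+ 3 ] ℤ.^ (r + r)
      ≡⟨ ℤ.^-distribˡ-+-* -[1+ 3 ] r (r + r) ⟨
    -[1+ 3 ] ℤ.^ (r + (r + r)) ∎
    where
    open ≡-Reasoning
    diagCoeff : Fin 3 → ℤ
    diagCoeff j = Weight.weightCoeff (dot paramWeights (diagonalMonomial j)) (H j j)
    det-leads = Weight.det3-Leads p H diagonalMonomial (λ i → ⟦ rowPotential i ⟧ s) (λ j → ⟦ columnPotential j ⟧ s)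
                  (λ j → proj₁ (H-Leads j)) diagonalMonomial-weight H-Below

  det-Homogeneous : Degree.Homogeneous (6 * r) (detHX p)
  det-Homogeneous = Degree.Homogeneous-≡ (lemma s) (Degree.det3-Homogeneous p _ H H-Homogeneous)
    where
    lemma : ∀ s → (2 * s + 2) + ((2 * s + 2) + (2 * s + 2)) ≡ 6 * suc s
    lemma = solve-∀

prime∣^⇒∣ : ∀ {p} m n → Prime p → p ∣ m ^ n → p ∣ m
prime∣^⇒∣ m zero    p-prime p∣1 = ⊥-elim (¬prime[1] (subst Prime (∣1⇒≡1 p∣1) p-prime))
prime∣^⇒∣ m (suc n) p-prime p∣m^n+1 with euclidsLemma m (m ^ n) p-prime p∣m^n+1
... | inj₁ p∣m   = p∣m
... | inj₂ p∣m^n = prime∣^⇒∣ m n p-prime p∣m^n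

∣^∣ : ∀ i n → ℤ.∣ i ℤ.^ n ∣ ≡ ℤ.∣ i ∣ ^ n
∣^∣ i zero    = refl
∣^∣ i (suc n) = trans (ℤ.abs-* i (i ℤ.^ n)) (cong (ℤ.∣ i ∣ *_) (∣^∣ i n))

odd-prime∤4^ : ∀ {p} n → Prime p → p ≢ 2 → ¬ p ∣ ℤ.∣ -[1+ 3 ] ℤ.^ n ∣
odd-prime∤4^ {p} n p-prime p≢2 p∣4^n =
  [ (λ p≡1 → ¬prime[1] (subst Prime p≡1 p-prime)) , p≢2 ] (irreducible[2] p∣2)
  where
  p∣2 : p ∣ 2
  p∣2 = prime∣^⇒∣ 2 2 p-prime (prime∣^⇒∣ 4 n p-prime (subst (p ∣_) (∣^∣ -[1+ 3 ] n) p∣4^n))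

Homogeneous⇒HomogeneousMod : ∀ q K P → Degree.Homogeneous K P → HomogeneousMod q K P
Homogeneous⇒HomogeneousMod q K P P-hom m q∤m with Vec.sum m ≟ K
... | yes m≡K = m≡K
... | no m≢K  = ⊥-elim (q∤m (subst (λ c → q ∣ ℤ.∣ c ∣) (sym (Degree.coeffP-Homogeneous P P-hom m≢K)) (q ∣0)))

proposition5p4 : (p : ℕ) → Prime p → p ≢ 2 →
    NonZeroMod p (detHX p) × HomogeneousMod p (6 * (p ∸ 1)) (detHX p)
proposition5p4 zero          p-prime _   = ⊥-elim (¬prime[0] p-prime)
proposition5p4 (suc zero)    p-prime _   = ⊥-elim (¬prime[1] p-prime)
proposition5p4 (suc (suc s)) p-prime p≢2 =
  (detLeadingMonomial , nonzero) ,
  Homogeneous⇒HomogeneousMod (suc (suc s)) (6 * suc s) (detHX (suc (suc s))) det-Homogeneous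
  where
  open AtPrime s
  nonzero : ¬ suc (suc s) ∣ ℤ.∣ coeffP detLeadingMonomial (detHX (suc (suc s))) ∣
  nonzero p∣c = odd-prime∤4^ (r + (r + r)) p-prime p≢2
    (subst (λ c → suc (suc s) ∣ ℤ.∣ c ∣) coeffP-detLeadingMonomial p∣c)
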